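{- Fix $k\ge 0$ and let $\pi=\pi_1\cdots\pi_n$ be an input permutation for the $\mathfrak{D}^k\mathfrak{I}$ machine. If $i<j$ and $\pi_i>\pi_j$, then in any sequence of legal operations of the machine, $\pi_i$ is pushed into the increasing stack $I$ before $\pi_j$.
   Context: The $\mathfrak{D}^k\mathfrak{I}$ machine consists of $k$ stacks $D_1,\dots,D_k$ in series ("decreasing stacks": at all times their elements must be in decreasing order from top to bottom, i.e. the top is the largest), followed by a stack $I$ ("increasing stack": its elements must be in increasing order from top to bottom, i.e. the top is the smallest). The input permutation $\pi$ is read from left to right. The operations are: $d_0$: push the next element of the input into $D_1$ (into $I$ if $k=0$); $d_i$ ($1\le i\le k-1$): pop the top of $D_i$ and push it into $D_{i+1}$; $d_k$: pop the top of $D_k$ and push it into $I$; $d_{k+1}$: pop the top of $I$ and append it to the right of the output. An operation is legal if it does not violate the order restrictions of the stacks; $d_{k+1}$ is considered legal if the element it outputs is the smallest element not yet output, or if no other operation is legal. -}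

module Defs where

open import Data.Nat using (ℕ; zero; suc; _<_; _≤_; _≡ᵇ_)
open import Data.Bool using (Bool; true; false; if_then_else_)
open import Data.Fin using (Fin; zero; suc; toℕ; inject₁; fromℕ)
open import Data.List using (List; []; _∷_; _++_; [_]; map; upTo)
open import Data.List.Membership.Propositional using (_∈_; _∉_)
open import Data.List.Relation.Binary.Permutation.Propositional using (_↭_)
open import Data.Vec using (Vec; lookup; replicate; toList; _[_]≔_)
open import Data.Maybe using (Maybe; just; nothing)
open import Data.Unit using (⊤)
open import Data.Product using (_×_)
open import Data.Sum using (_⊎_)
open import Relation.Binary.PropositionalEquality using (_≡_)

IsPerm : (n : ℕ) → Vec ℕ n → Set
IsPerm n π = toList π ↭ map suc (upTo n)

-- The 𝔇^k𝔍 machine.  Stacks are lists with the head being the top.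
-- The stacks are indexed by Fin (suc k): index m < k is D_{m+1},
-- index k (= fromℕ k) is the increasing stack I.
record State (k : ℕ) : Set where
  constructor mkState
  field
    input  : List ℕ
    stacks : Vec (List ℕ) (suc k)
    output : List ℕ
open State public

initial : (k : ℕ) → List ℕ → State k
initial k π = mkState π (replicate (suc k) []) []

isI : {k : ℕ} → Fin (suc k) → Bool
isI {k} m = toℕ m ≡ᵇ k

-- Pushing x on stack m (current contents s) respects the order restriction:
-- decreasing stacks D_i have their largest element on top,
-- the increasing stack I has its smallest element on top.
Fits : {k : ℕ} → Fin (suc k) → ℕ → List ℕ → Set
Fits m x [] = ⊤
Fits m x (t ∷ _) = if isI m then x < t else t < x

-- Operations: push = d₀, move m = d_{m+1} (pop D_{m+1}, push into next stack), pop = d_{k+1}.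
data Op (k : ℕ) : Set where
  push : Op k
  move : Fin k → Op k
  pop  : Op k

data Step {k : ℕ} : State k → Op k → ℕ → State k → Set where
  stepPush : ∀ {x rest st out} → Fits {k} zero x (lookup st zero) →
    Step (mkState (x ∷ rest) st out) push x
         (mkState rest (st [ zero ]≔ (x ∷ lookup st zero)) out)
  stepMove : ∀ {inp st out x r} (m : Fin k) →
    lookup st (inject₁ m) ≡ x ∷ r →
    Fits (suc m) x (lookup st (suc m)) →
    Step (mkState inp st out) (move m) x
         (mkState inp ((st [ inject₁ m ]≔ r) [ suc m ]≔ (x ∷ lookup st (suc m))) out)
  stepPop : ∀ {inp st out x r} →
    lookup st (fromℕ k) ≡ x ∷ r →
    Step (mkState inp st out) pop x
         (mkState inp (st [ fromℕ k ]≔ r) (out ++ [ x ]))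

Legal : {k : ℕ} → List ℕ → State k → Op k → ℕ → State k → Set
Legal π s push x s' = Step s push x s'
Legal π s (move m) x s' = Step s (move m) x s'
Legal {k} π s pop x s' = Step s pop x s' ×
  ((∀ y → y ∈ π → y ∉ output s → x ≤ y) ⊎
   (∀ (o : Op k) y s'' → Step s o y s'' → o ≡ pop))

target : {k : ℕ} → Op k → Maybe (Fin (suc k))
target push = just zero
target (move m) = just (suc m)
target pop = nothing

IntoI : {k : ℕ} → Op k → Set
IntoI {k} o = target o ≡ just (fromℕ k)

record Execution (k : ℕ) (π : List ℕ) : Set where
  field
    len   : ℕ
    state : ℕ → State k
    op    : ℕ → Op k
    elem  : ℕ → ℕ
    start : state 0 ≡ initial k π
    legal : ∀ t → t < len → Legal π (state t) (op t) (elem t) (state (suc t))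
open Execution public

module Submission where

-- Fix b = π_j < a = π_i with i < j, so a enters the machine
-- before b.  As long as a has not yet been pushed into I, the configuration
-- satisfies the invariant "a is ahead of b" (the data type Ahead below):
--   * either a is still in the input and b is neither before it in the input
--     nor in any decreasing stack, or
--   * a lies in some decreasing stack D_l and b lies in no D_l' with l' ≥ l.
-- The only delicate step is when b is pushed onto the very stack D_l holding a:
-- since D_l is decreasing, b would have to exceed every element of D_l,
-- in particular a > b, which is impossible.  Every other step preserves the
-- invariant or pushes a into I; and a step pushing b into I contradicts it.

open import Defs
open import Data.Nat using (ℕ; zero; suc; _<_; _≤_; _>_; _≡ᵇ_; z≤n; s≤s)
open import Data.Nat.Properties
  using (≤-refl; ≤-trans; ≤-<-trans; <⇒≤; <-trans; <-asym; <-irrefl; n≮0; suc-injective; ≡ᵇ⇒≡;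
         ≤∧≢⇒<; m≤n⇒m<n∨m≡n; m<n⇒m<1+n; n<1+n; n≤1+n; ≤-pred)
open import Data.Fin using (Fin; zero; suc; toℕ; inject₁; fromℕ; _≟_)
  renaming (_<_ to _<ᶠ_)
open import Data.Fin.Properties using (toℕ-injective; toℕ-fromℕ; toℕ-inject₁; toℕ<n; toℕ≤pred[n])
open import Data.Vec using (Vec; _∷_; lookup; toList; replicate; _[_]≔_)
open import Data.Vec.Properties using (lookup∘update; lookup∘update′; lookup-replicate)
open import Data.Vec.Membership.Propositional.Properties using (∈-lookup; ∈-toList⁺)
open import Data.List using (List; []; _∷_; _++_)
open import Data.List.Properties using (∷-injectiveˡ)
open import Data.List.Membership.Propositional using (_∈_; _∉_)
open import Data.List.Relation.Unary.Any using (here; there)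
open import Data.List.Relation.Unary.All using () renaming (lookup to All-lookup)
open import Data.List.Relation.Unary.AllPairs using (_∷_)
open import Data.List.Relation.Unary.Linked using (Linked; []; [-]; _∷_; tail)
open import Data.List.Relation.Unary.Linked.Properties using (Linked⇒AllPairs)
open import Data.List.Relation.Unary.Unique.Propositional using (Unique)
open import Data.List.Relation.Unary.Unique.Propositional.Properties using (map⁺; upTo⁺)
open import Data.List.Relation.Binary.Permutation.Propositional using (↭-sym; ↭⇒↭ₛ)
open import Data.List.Relation.Binary.Permutation.Setoid.Properties as Permₛ using ()
open import Data.Maybe using (Maybe; just; nothing)
open import Data.Maybe.Properties using (just-injective)
open import Data.Product using (Σ; _×_; _,_)
open import Data.Sum using (_⊎_; inj₁; inj₂; map₁; map₂)
open import Data.Bool using (true; false; T)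
open import Data.Empty using (⊥; ⊥-elim)
open import Relation.Nullary using (yes; no)
open import Relation.Binary.PropositionalEquality
  using (_≡_; _≢_; refl; sym; trans; cong; subst; setoid)

perm⇒unique : ∀ {n} (π : Vec ℕ n) → IsPerm n π → Unique (toList π)
perm⇒unique {n} π perm =
  Permₛ.Unique-resp-↭ (setoid ℕ) (↭⇒↭ₛ (↭-sym perm)) (map⁺ suc-injective (upTo⁺ n))

split-before : ∀ {n} (π : Vec ℕ n) → Unique (toList π) → ∀ {i j} → i <ᶠ j →
  Σ (List ℕ) λ p → Σ (List ℕ) λ q → toList π ≡ p ++ lookup π i ∷ q × lookup π j ∉ p
split-before (x ∷ π) _ {zero} {suc j} _ = [] , toList π , refl , λ ()
split-before (x ∷ π) (x∉π ∷ u) {suc i} {suc j} (s≤s i<j)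
  with split-before π u i<j
... | p , q , eq , πj∉p = x ∷ p , q , cong (x ∷_) eq , λ
  { (here πj≡x) → All-lookup x∉π (∈-toList⁺ (∈-lookup j π)) (sym πj≡x)
  ; (there πj∈p) → πj∉p πj∈p }

variable
  x y : ℕ
  xs ys : List ℕ

Decreasing : List ℕ → Set
Decreasing = Linked _>_

decreasing-top : ∀ {t ts y} → Decreasing (t ∷ ts) → y ∈ t ∷ ts → y ≤ t
decreasing-top _ (here refl) = ≤-refl
decreasing-top dec (there y∈ts) with Linked⇒AllPairs (λ x>y y>z → <-trans y>z x>y) dec
... | t>ts ∷ _ = <⇒≤ (All-lookup t>ts y∈ts)

module _ {k : ℕ} where

  variable
    s s' : State k
    o : Op k
    l : Fin (suc k)

  fits-decreasing : ∀ {l : Fin (suc k)} {x t ts} → toℕ l < k → Fits l x (t ∷ ts) → t < x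
  fits-decreasing {l} l<k with toℕ l ≡ᵇ k in isI≡
  ... | false = λ t<x → t<x
  ... | true  = ⊥-elim (<-irrefl (≡ᵇ⇒≡ (toℕ l) k (subst T (sym isI≡) _)) l<k)

  fits-above : ∀ {l : Fin (suc k)} {x y xs} → toℕ l < k →
    Decreasing xs → y ∈ xs → Fits l x xs → y < x
  fits-above {xs = []} _ _ () _
  fits-above {l = l} {x} {xs = t ∷ ts} l<k dec y∈ fits =
    ≤-<-trans (decreasing-top dec y∈) (fits-decreasing {l = l} {x} {t} {ts} l<k fits)

  push-decreasing : ∀ {l : Fin (suc k)} {x xs} → toℕ l < k →
    Fits l x xs → Decreasing xs → Decreasing (x ∷ xs)
  push-decreasing {xs = []} _ _ _ = [-]
  push-decreasing {l = l} {x} {t ∷ ts} l<k fits dec = fits-decreasing {l = l} {x} {t} {ts} l<k fits ∷ dec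

  source : Op k → Maybe (Fin (suc k))
  source push = nothing
  source (move m) = just (inject₁ m)
  source pop = just (fromℕ k)

  inject₁<k : (m : Fin k) → toℕ (inject₁ m) < k
  inject₁<k m = subst (_< _) (sym (toℕ-inject₁ m)) (toℕ<n m)

  below-I : (l : Fin (suc k)) → l ≢ fromℕ k → toℕ l < k
  below-I l l≢I =
    ≤∧≢⇒< (toℕ≤pred[n] l) (λ l≡k → l≢I (toℕ-injective (trans l≡k (sym (toℕ-fromℕ k)))))

  step-source : Step s o x s' → source o ≡ just l → Σ (List ℕ) λ r → lookup (stacks s) l ≡ x ∷ r
  step-source (stepMove _ top _) refl = _ , top
  step-source (stepPop top) refl = _ , top

  lands-on-target : Step s o x s' → target o ≡ just l → x ∈ lookup (stacks s') l
  lands-on-target (stepPush {st = st} _) refl =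
    subst (_ ∈_) (sym (lookup∘update zero st _)) (here refl)
  lands-on-target (stepMove {st = st} {r = r} m _ _) refl =
    subst (_ ∈_) (sym (lookup∘update (suc m) (st [ inject₁ m ]≔ r) _)) (here refl)

  data StackChange (o : Op k) (x : ℕ) (l : Fin (suc k)) : List ℕ → List ℕ → Set where
    kept   : StackChange o x l xs xs
    pushed : target o ≡ just l → Fits l x xs → StackChange o x l xs (x ∷ xs)
    popped : source o ≡ just l → StackChange o x l (x ∷ xs) xs

  step-stack : Step s o x s' → (l : Fin (suc k)) →
    StackChange o x l (lookup (stacks s) l) (lookup (stacks s') l)
  step-stack (stepPush {x = x} {st = st} fits) l with l ≟ zero
  ... | yes refl rewrite lookup∘update zero st (x ∷ lookup st zero) = pushed refl fits
  ... | no l≢0 rewrite lookup∘update′ l≢0 st (x ∷ lookup st zero) = kept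
  step-stack (stepMove {st = st} {x = x} {r = r} m top fits) l with l ≟ suc m
  ... | yes refl rewrite lookup∘update (suc m) (st [ inject₁ m ]≔ r) (x ∷ lookup st (suc m)) =
    pushed refl fits
  ... | no l≢target
    rewrite lookup∘update′ l≢target (st [ inject₁ m ]≔ r) (x ∷ lookup st (suc m))
    with l ≟ inject₁ m
  ...   | yes refl rewrite lookup∘update (inject₁ m) st r | top = popped refl
  ...   | no l≢source rewrite lookup∘update′ l≢source st r = kept
  step-stack (stepPop {st = st} {r = r} top) l with l ≟ fromℕ k
  ... | yes refl rewrite lookup∘update (fromℕ k) st r | top = popped refl
  ... | no l≢I rewrite lookup∘update′ l≢I st r = kept

  change-new : StackChange o x l xs ys → y ∈ ys → y ∈ xs ⊎ (y ≡ x × target o ≡ just l)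
  change-new kept y∈ = inj₁ y∈
  change-new (pushed tgt _) (here y≡x) = inj₂ (y≡x , tgt)
  change-new (pushed _ _) (there y∈) = inj₁ y∈
  change-new (popped _) y∈ = inj₁ (there y∈)

  change-old : StackChange o x l xs ys → y ∈ xs → y ∈ ys ⊎ (y ≡ x × source o ≡ just l)
  change-old kept y∈ = inj₁ y∈
  change-old (pushed _ _) y∈ = inj₁ (there y∈)
  change-old (popped src) (here y≡x) = inj₂ (y≡x , src)
  change-old (popped _) (there y∈) = inj₁ y∈

  change-decreasing : toℕ l < k → StackChange o x l xs ys → Decreasing xs → Decreasing ys
  change-decreasing _ kept dec = dec
  change-decreasing {l = l} l<k (pushed _ fits) dec = push-decreasing {l = l} l<k fits dec
  change-decreasing _ (popped _) dec = tail dec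

  AllDecreasing : Vec (List ℕ) (suc k) → Set
  AllDecreasing st = ∀ l → toℕ l < k → Decreasing (lookup st l)

  decreasing-step : Step s o x s' → AllDecreasing (stacks s) → AllDecreasing (stacks s')
  decreasing-step st D l l<k = change-decreasing l<k (step-stack st l) (D l l<k)

  legal⇒step : ∀ {π} → Legal π s o x s' → Step s o x s'
  legal⇒step {o = push} step = step
  legal⇒step {o = move _} step = step
  legal⇒step {o = pop} (step , _) = step

  until-event : ∀ {π} (E : Execution k π) (P : State k → Set) (Q : ℕ → Set) →
    P (state E 0) → (∀ t → t < len E → P (state E t) → Q t ⊎ P (state E (suc t))) →
    ∀ T → T ≤ len E → (Σ ℕ λ t → t < T × Q t) ⊎ P (state E T)
  until-event E P Q P₀ next zero _ = inj₂ P₀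
  until-event E P Q P₀ next (suc T) T<len with until-event E P Q P₀ next T (<⇒≤ T<len)
  ... | inj₁ (t , t<T , Qt) = inj₁ (t , m<n⇒m<1+n t<T , Qt)
  ... | inj₂ PT with next T T<len PT
  ...   | inj₁ QT = inj₁ (T , n<1+n T , QT)
  ...   | inj₂ PT+1 = inj₂ PT+1

  module Overtaking {a b : ℕ} (b<a : b < a) where

    a≢b : a ≢ b
    a≢b a≡b = <-irrefl (sym a≡b) b<a

    Clear : Vec (List ℕ) (suc k) → ℕ → Set
    Clear st h = ∀ l → h ≤ toℕ l → toℕ l < k → b ∉ lookup st l

    data Ahead (s : State k) : Set where
      waiting : ∀ p q → input s ≡ p ++ a ∷ q → b ∉ p → Clear (stacks s) 0 → Ahead s
      stacked : ∀ l → toℕ l < k → a ∈ lookup (stacks s) l → Clear (stacks s) (toℕ l) → Ahead s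

    clear-mono : ∀ {st : Vec (List ℕ) (suc k)} {h h'} → h ≤ h' → Clear st h → Clear st h'
    clear-mono h≤h' C l h'≤l = C l (≤-trans h≤h' h'≤l)

    clear-step : ∀ {h} → Step s o x s' → Clear (stacks s) h →
      (∀ {l} → target o ≡ just l → h ≤ toℕ l → toℕ l < k → x ≢ b) → Clear (stacks s') h
    clear-step st C guard l h≤l l<k b∈ with change-new (step-stack st l) b∈
    ... | inj₁ b∈old = C l h≤l l<k b∈old
    ... | inj₂ (b≡x , tgt) = guard tgt h≤l l<k (sym b≡x)

    from-clear : ∀ {h} → Step s o x s' → Clear (stacks s) h →
      source o ≡ just l → h ≤ toℕ l → toℕ l < k → x ≢ b
    from-clear st C src h≤l l<k refl with step-source st src
    ... | _ , top = C _ h≤l l<k (subst (b ∈_) (sym top) (here refl))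

    -- b can never be put onto a decreasing stack containing a: it would have to exceed a.
    blocked : toℕ l < k → Decreasing xs → a ∈ xs → Fits l x xs → x ≢ b
    blocked {l = l} l<k dec a∈ fits refl = <-asym b<a (fits-above {l = l} l<k dec a∈ fits)

    -- While a lies in D_l and b lies in no stack from D_l on, no step brings b there:
    -- it would come either from a stack from D_l on, or onto D_l itself.
    no-overtaking : Step s o x s' → AllDecreasing (stacks s) → toℕ l < k →
      a ∈ lookup (stacks s) l → Clear (stacks s) (toℕ l) →
      ∀ {l'} → target o ≡ just l' → toℕ l ≤ toℕ l' → toℕ l' < k → x ≢ b
    no-overtaking {l = zero} (stepPush fits) D l<k a∈ _ refl _ _ =
      blocked {l = zero} l<k (D zero l<k) a∈ fits
    no-overtaking {l = suc _} (stepPush _) _ _ _ _ refl () _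
    no-overtaking {l = l} st@(stepMove m _ fits) D l<k a∈ C refl l≤m+1 _
      with m≤n⇒m<n∨m≡n l≤m+1
    ... | inj₁ (s≤s l≤m) =
      from-clear st C refl (subst (toℕ l ≤_) (sym (toℕ-inject₁ m)) l≤m) (inject₁<k m)
    ... | inj₂ l≡m+1 with toℕ-injective {i = l} {j = suc m} l≡m+1
    ...   | refl = blocked {l = suc m} l<k (D (suc m) l<k) a∈ fits
    no-overtaking (stepPop _) _ _ _ _ () _ _

    advance : Step s o a s' → toℕ l < k → source o ≡ just l →
      Clear (stacks s) (toℕ l) → IntoI o ⊎ Ahead s'
    advance (stepPush _) _ () _
    advance (stepPop _) l<k refl _ = ⊥-elim (<-irrefl (toℕ-fromℕ k) l<k)
    advance st@(stepMove {st = stk} m _ _) _ refl C with suc m ≟ fromℕ k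
    ... | yes m+1≡I = inj₁ (cong just m+1≡I)
    ... | no m+1≢I = inj₂ (stacked (suc m) (below-I (suc m) m+1≢I) (lands-on-target st refl)
            (clear-step st (clear-mono {st = stk} inject₁≤suc C) λ _ _ _ → a≢b))
      where
      inject₁≤suc : toℕ (inject₁ m) ≤ suc (toℕ m)
      inject₁≤suc = subst (_≤ suc (toℕ m)) (sym (toℕ-inject₁ m)) (n≤1+n (toℕ m))

    ahead-step : Step s o x s' → AllDecreasing (stacks s) → Ahead s → (IntoI o × x ≡ a) ⊎ Ahead s'
    ahead-step st@(stepPush _) _ (waiting [] _ refl _ C) with zero ≟ fromℕ k
    ... | yes 0≡I = inj₁ (cong just 0≡I , refl)
    ... | no 0≢I = inj₂ (stacked zero (below-I zero 0≢I) (lands-on-target st refl)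
            (clear-step st C λ _ _ _ → a≢b))
    ahead-step st@(stepPush _) _ (waiting (_ ∷ p) q refl b∉ C) =
      inj₂ (waiting p q refl (λ b∈p → b∉ (there b∈p))
              (clear-step st C λ _ _ _ x≡b → b∉ (here (sym x≡b))))
    ahead-step st@(stepMove m _ _) _ (waiting p q eq b∉ C) =
      inj₂ (waiting p q eq b∉ (clear-step st C λ { refl _ _ → from-clear st C refl z≤n (inject₁<k m) }))
    ahead-step st@(stepPop _) _ (waiting p q eq b∉ C) =
      inj₂ (waiting p q eq b∉ (clear-step st C λ ()))
    ahead-step st D (stacked l l<k a∈ C) with change-old (step-stack st l) a∈
    ... | inj₁ a∈′ = inj₂ (stacked l l<k a∈′ (clear-step st C (no-overtaking st D l<k a∈ C)))
    ... | inj₂ (refl , src) = map₁ (_, refl) (advance st l<k src C)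

    b-not-first : Step s o b s' → IntoI o → Ahead s → ⊥
    b-not-first (stepPush _) _ (waiting [] _ b∷rest≡a∷q _ _) = a≢b (sym (∷-injectiveˡ b∷rest≡a∷q))
    b-not-first (stepPush _) _ (waiting (_ ∷ _) _ eq b∉ _) = b∉ (here (∷-injectiveˡ eq))
    b-not-first (stepPush _) 0≡I (stacked l l<k _ _) = n≮0 (subst (toℕ l <_) k≡0 l<k)
      where
      k≡0 : k ≡ 0
      k≡0 = trans (sym (toℕ-fromℕ k)) (sym (cong toℕ (just-injective 0≡I)))
    b-not-first st@(stepMove m _ _) _ (waiting _ _ _ _ C) = from-clear st C refl z≤n (inject₁<k m) refl
    b-not-first st@(stepMove m _ _) m+1≡I (stacked l l<k _ C) = from-clear st C refl l≤m (inject₁<k m) refl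
      where
      k≡m+1 : k ≡ suc (toℕ m)
      k≡m+1 = trans (sym (toℕ-fromℕ k)) (sym (cong toℕ (just-injective m+1≡I)))
      l≤m : toℕ l ≤ toℕ (inject₁ m)
      l≤m = subst (toℕ l ≤_) (sym (toℕ-inject₁ m)) (≤-pred (subst (toℕ l <_) k≡m+1 l<k))
    b-not-first (stepPop _) () _

    Invariant : State k → Set
    Invariant s = AllDecreasing (stacks s) × Ahead s

    invariant-step : Step s o x s' → Invariant s → (IntoI o × x ≡ a) ⊎ Invariant s'
    invariant-step st (D , ahead) = map₂ (decreasing-step st D ,_) (ahead-step st D ahead)

    initially : ∀ {π} p q → π ≡ p ++ a ∷ q → b ∉ p → Invariant (initial k π)
    initially p q π≡ b∉p = empty-decreasing , waiting p q π≡ b∉p empty-clear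
      where
      empty : (l : Fin (suc k)) → lookup (replicate (suc k) []) l ≡ []
      empty l = lookup-replicate l []
      empty-decreasing : AllDecreasing (replicate (suc k) [])
      empty-decreasing l _ = subst Decreasing (sym (empty l)) []
      empty-clear : Clear (replicate (suc k) []) 0
      empty-clear l _ _ b∈ with subst (b ∈_) (empty l) b∈
      ... | ()

    a-first : ∀ {π} (E : Execution k π) → Invariant (state E 0) →
      ∀ t → t < len E → IntoI (op E t) → elem E t ≡ b →
      Σ ℕ λ t′ → t′ < t × IntoI (op E t′) × elem E t′ ≡ a
    a-first E inv₀ t t<len into-I moved-b
      with until-event E Invariant (λ t′ → IntoI (op E t′) × elem E t′ ≡ a) inv₀
             (λ t′ t′<len → invariant-step (legal⇒step (legal E t′ t′<len))) t (<⇒≤ t<len)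
    ... | inj₁ a-pushed = a-pushed
    ... | inj₂ (_ , ahead) = ⊥-elim (b-not-first moves-b into-I ahead)
      where
      moves-b : Step (state E t) (op E t) b (state E (suc t))
      moves-b = subst (λ y → Step (state E t) (op E t) y (state E (suc t))) moved-b
                  (legal⇒step (legal E t t<len))

-- Since π_i precedes π_j in the input and π_j < π_i, the invariant holds initially.
lemma1 : (k n : ℕ) (π : Vec ℕ n) → IsPerm n π → (i j : Fin n) → i <ᶠ j →
    lookup π j < lookup π i → (E : Execution k (toList π)) →
    (t : ℕ) → t < len E → IntoI (op E t) → elem E t ≡ lookup π j →
    Σ ℕ (λ s → s < t × IntoI (op E s) × elem E s ≡ lookup π i)
lemma1 k n π perm i j i<j πj<πi E =
  let (p , q , π≡ , πj∉p) = split-before π (perm⇒unique π perm) i<j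
  in  a-first E (subst Invariant (sym (start E)) (initially p q π≡ πj∉p))
  where open Overtaking {k} πj<πi
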